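{- The TPTL-formula $\varphi=x_1.\mathsf{F}\big(x_1\in[1,+\infty)\wedge x_2.\mathsf{F}(x_1\in[1,+\infty)\wedge x_2\in(-\infty,-1])\big)$, which uses two register variables $x_1,x_2$, is not equivalent to any TPTL-formula that uses at most one register variable. Consequently $\mathrm{TPTL}^2$ is strictly more expressive than $\mathrm{TPTL}^1$.
   Context: Let $\mathcal{P}$ be a finite set of propositional variables. A data word is an infinite sequence $w=(P_0,d_0)(P_1,d_1)\dots$ with $P_i\subseteq\mathcal{P}$ and $d_i\in\mathbb{N}$. Intervals $I$ are (half-)open or (half-)closed intervals of integers with endpoints in $\mathbb{Z}\cup\{\pm\infty\}$. TPTL formulas: $\varphi::=p\mid x\in I\mid\neg\varphi\mid\varphi_1\wedge\varphi_2\mid\varphi_1\mathsf{U}\varphi_2\mid x.\varphi$ with register variables $x$; with a valuation $\nu$ of registers in $\mathbb{N}$: $(w,i,\nu)\models p$ iff $p\in P_i$; $(w,i,\nu)\models x\in I$ iff $d_i-\nu(x)\in I$; $(w,i,\nu)\models x.\varphi$ iff $(w,i,\nu[x\mapsto d_i])\models\varphi$; $(w,i,\nu)\models\varphi_1\mathsf{U}\varphi_2$ iff there is $j>i$ with $(w,j,\nu)\models\varphi_2$ and $(w,k,\nu)\models\varphi_1$ for all $i<k<j$; booleans as usual. $w\models\varphi$ iff $(w,0,\nu_0)\models\varphi$ with $\nu_0$ mapping every register to $d_0$. $\mathsf{F}\varphi:=\mathrm{true}\,\mathsf{U}\,\varphi$. $\mathrm{TPTL}^n$ denotes TPTL formulas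 using at most $n$ distinct register variables. Two formulas are equivalent if they are satisfied by the same data words; a logic is strictly more expressive than another if every formula of the latter has an equivalent in the former but not conversely. -}

module Defs where

open import Data.Nat using (ℕ; suc; _≟_) renaming (_<_ to _<ℕ_; _≤_ to _≤ℕ_)
open import Data.List using (List; []; _∷_; _++_; length)
open import Relation.Nullary using (yes; no)
open import Data.Integer using (ℤ; _-_; _≤_; _<_; +_; -_)
open import Data.Fin using (Fin)
open import Data.Fin.Subset using (Subset; _∈_)
open import Data.Product using (_×_; Σ; ∃; proj₁; proj₂)
open import Data.Sum using (_⊎_)
open import Data.Unit using (⊤)
open import Data.Empty using (⊥)
open import Relation.Nullary using (¬_)
open import Relation.Binary.PropositionalEquality using (_≡_)
open import Function.Bundles using (_⇔_)

Reg : Set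
Reg = ℕ

data Lower : Set where
  -∞     : Lower
  closedL : ℤ → Lower
  openL   : ℤ → Lower

data Upper : Set where
  +∞      : Upper
  closedU : ℤ → Upper
  openU   : ℤ → Upper

record Interval : Set where
  constructor ⟨_,_⟩
  field
    lo : Lower
    hi : Upper

aboveL : Lower → ℤ → Set
aboveL -∞ z = ⊤
aboveL (closedL a) z = a ≤ z
aboveL (openL a) z = a < z

belowU : Upper → ℤ → Set
belowU +∞ z = ⊤
belowU (closedU b) z = z ≤ b
belowU (openU b) z = z < b

_∈I_ : ℤ → Interval → Set
z ∈I ⟨ l , u ⟩ = aboveL l z × belowU u z

data TPTL (k : ℕ) : Set where
  prop  : Fin k → TPTL k
  _∈ᵣ_  : Reg → Interval → TPTL k
  ¬'_   : TPTL k → TPTL k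
  _∧'_  : TPTL k → TPTL k → TPTL k
  _U_   : TPTL k → TPTL k → TPTL k
  _·_   : Reg → TPTL k → TPTL k

DataWord : ℕ → Set
DataWord k = ℕ → Subset k × ℕ

Valuation : Set
Valuation = Reg → ℕ

_[_↦_] : Valuation → Reg → ℕ → Valuation
(ν [ x ↦ d ]) y with y ≟ x
... | yes _ = d
... | no _ = ν y

Sat : ∀ {k} → DataWord k → ℕ → Valuation → TPTL k → Set
Sat w i ν (prop p) = p ∈ proj₁ (w i)
Sat w i ν (x ∈ᵣ I) = ((+ proj₂ (w i)) - (+ ν x)) ∈I I
Sat w i ν (¬' φ) = ¬ Sat w i ν φ
Sat w i ν (φ ∧' ψ) = Sat w i ν φ × Sat w i ν ψ
Sat w i ν (φ U ψ) =
  ∃ λ j → (i <ℕ j) × Sat w j ν ψ ×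
          (∀ k → i <ℕ k → k <ℕ j → Sat w k ν φ)
Sat w i ν (x · φ) = Sat w i (ν [ x ↦ proj₂ (w i) ]) φ

_⊨_ : ∀ {k} → DataWord k → TPTL k → Set
w ⊨ φ = Sat w 0 (λ _ → proj₂ (w 0)) φ

true' : ∀ {k} → TPTL k
true' = ¬' ((¬' (0 ∈ᵣ ⟨ -∞ , +∞ ⟩)) ∧' (0 ∈ᵣ ⟨ -∞ , +∞ ⟩))

F_ : ∀ {k} → TPTL k → TPTL k
F φ = true' U φ

_≈_ : ∀ {k} → TPTL k → TPTL k → Set
φ ≈ ψ = ∀ w → (w ⊨ φ) ⇔ (w ⊨ ψ)

regs : ∀ {k} → TPTL k → List Reg
regs (prop p) = []
regs (x ∈ᵣ I) = x ∷ []
regs (¬' φ) = regs φ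
regs (φ ∧' ψ) = regs φ ++ regs ψ
regs (φ U ψ) = regs φ ++ regs ψ
regs (x · φ) = x ∷ regs φ

open import Data.List.Membership.Propositional as M using ()
InTPTL : ∀ {k} → ℕ → TPTL k → Set
InTPTL {k} n φ = ∃ λ (rs : List Reg) → (length rs ≤ℕ n) ×
                   (∀ x → x M.∈ regs φ → x M.∈ rs)

AtLeastAsExpressive : ℕ → ℕ → Set
AtLeastAsExpressive n m = ∀ k (φ : TPTL k) → InTPTL m φ →
                          ∃ λ ψ → InTPTL n ψ × (φ ≈ ψ)

StrictlyMoreExpressive : ℕ → ℕ → Set
StrictlyMoreExpressive n m = AtLeastAsExpressive n m × ¬ AtLeastAsExpressive m n

I-1-inf : Interval
I-1-inf = ⟨ closedL (+ 1) , +∞ ⟩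

I-inf-m1 : Interval
I-inf-m1 = ⟨ -∞ , closedU (- (+ 1)) ⟩

φ₁₃ : (k : ℕ) → TPTL k
φ₁₃ k = 1 · (F ((1 ∈ᵣ I-1-inf) ∧' (2 · (F ((1 ∈ᵣ I-1-inf) ∧' (2 ∈ᵣ I-inf-m1))))))

-- Scale the data by some N exceeding every constant of a one-register formula ψ: a test
-- x ∈ I then only sees whether the current value is below, equal to or above the register.
-- With m the until-depth of ψ, compare
--   W  = 3+m, 5+m, 2, 3, …, m+1, 4+m, m+6, m+7, …   (φ₁₃ holds: 5+m, later 4+m, both above 3+m)
--   W′ = 3+m, 5+m, 2, 3, …, m+1, 2+m, m+6, m+7, …   (φ₁₃ fails)
-- Duplicator wins the until-depth-m Ehrenfeucht–Fraïssé game on W, W′. While the register still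
-- holds 3+m both words look like  = > <ᵏ >^ω  with k = m resp. m+1, and until-depth m cannot
-- count that far; once the register is reset at a position ≥ 1, the remaining suffixes of W and W′
-- are order-isomorphic relative to it. So ψ cannot tell W from W′, unlike φ₁₃.

module Submission where

open import Defs
open import Data.Nat as ℕ
  using (ℕ; zero; suc; _+_; _*_; _∸_; _⊔_; _≤_; _<_; z≤n; s≤s; _<?_; _≟_; >-nonZero)
open import Data.Nat.Properties
open import Data.Integer as ℤ using (ℤ; +_; -_; +≤+; +<+; -<-; -<+; ∣_∣)
import Data.Integer.Properties as ℤ
open import Data.Product using (_×_; _,_; Σ; ∃; proj₁; proj₂)
open import Data.Product.Function.NonDependent.Propositional using (_×-⇔_)
open import Data.Sum using (_⊎_; inj₁; inj₂)
open import Data.Empty using (⊥-elim)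
open import Data.Unit using (tt)
open import Data.Fin.Subset using () renaming (⊥ to ∅)
open import Data.List using ([]; _∷_)
open import Data.List.Relation.Unary.Any using (here)
open import Data.List.Relation.Unary.All as All using (All; []; _∷_; all?)
open import Data.List.Relation.Unary.All.Properties using (++⁻ˡ; ++⁻ʳ)
open import Data.List.Membership.DecPropositional ℕ._≟_ using (_∈_; _∈?_)
open import Function using (id; _∘_; case_of_)
open import Function.Bundles using (_⇔_; mk⇔; Equivalence)
open import Function.Properties.Equivalence using () renaming (trans to ⇔-trans)
open import Function.Related.TypeIsomorphisms using (¬-cong-⇔)
open import Relation.Nullary using (¬_; yes; no; contradiction)
open import Relation.Nullary.Decidable using (toWitness)
open import Relation.Binary using (tri<; tri≈; tri>)
open import Relation.Binary.PropositionalEquality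
  using (_≡_; _≢_; refl; sym; trans; subst; subst₂)

-- Order types and interval tests on scaled data

data SameOrder (x y x′ y′ : ℕ) : Set where
  both< : x < y → x′ < y′ → SameOrder x y x′ y′
  both≡ : x ≡ y → x′ ≡ y′ → SameOrder x y x′ y′
  both> : y < x → y′ < x′ → SameOrder x y x′ y′

SameOrder-sym : ∀ {x y x′ y′} → SameOrder x y x′ y′ → SameOrder x′ y′ x y
SameOrder-sym (both< p q) = both< q p
SameOrder-sym (both≡ p q) = both≡ q p
SameOrder-sym (both> p q) = both> q p

SameOrder-flip : ∀ {x y x′ y′} → SameOrder x y x′ y′ → SameOrder y x y′ x′
SameOrder-flip (both< p q) = both> p q
SameOrder-flip (both≡ p q) = both≡ (sym p) (sym q)
SameOrder-flip (both> p q) = both< p q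

SameOrder-refl : ∀ x y → SameOrder x y x y
SameOrder-refl x y with <-cmp x y
... | tri< p _ _ = both< p p
... | tri≈ _ p _ = both≡ p p
... | tri> _ _ p = both> p p

data Indiscernible (N : ℕ) (z z′ : ℤ) : Set where
  equal   : z ≡ z′ → Indiscernible N z z′
  both≥N  : + N ℤ.≤ z → + N ℤ.≤ z′ → Indiscernible N z z′
  both≤-N : z ℤ.≤ - + N → z′ ℤ.≤ - + N → Indiscernible N z z′

lowerBound : Lower → ℕ
lowerBound -∞          = 0
lowerBound (closedL a) = ∣ a ∣
lowerBound (openL a)   = ∣ a ∣

upperBound : Upper → ℕ
upperBound +∞          = 0
upperBound (closedU b) = ∣ b ∣
upperBound (openU b)   = ∣ b ∣

bound : Interval → ℕ
bound ⟨ l , u ⟩ = lowerBound l ⊔ upperBound u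

∣a∣<N⇒a<N : ∀ {a N} → ∣ a ∣ < N → a ℤ.< + N
∣a∣<N⇒a<N {+ _}      h = +<+ h
∣a∣<N⇒a<N {ℤ.-[1+ _ ]} h = -<+

∣a∣<N⇒-N<a  : ∀ {a N} → ∣ a ∣ < N → - + N ℤ.< a
∣a∣<N⇒-N<a {+ _}      {suc N} h       = -<+
∣a∣<N⇒-N<a {ℤ.-[1+ _ ]} {suc N} (s≤s h) = -<- h

aboveL-indiscernible : ∀ {N z z′} l → lowerBound l < N → Indiscernible N z z′ → aboveL l z → aboveL l z′
aboveL-indiscernible l           _ (equal refl)      h = h
aboveL-indiscernible -∞          _ _                 _ = tt
aboveL-indiscernible (closedL a) b (both≥N _ N≤z′)   _ = ℤ.<⇒≤ (ℤ.<-≤-trans (∣a∣<N⇒a<N b) N≤z′)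
aboveL-indiscernible (closedL a) b (both≤-N z≤-N _)  h = ⊥-elim (ℤ.<⇒≱ (∣a∣<N⇒-N<a b) (ℤ.≤-trans h z≤-N))
aboveL-indiscernible (openL a)   b (both≥N _ N≤z′)   _ = ℤ.<-≤-trans (∣a∣<N⇒a<N b) N≤z′
aboveL-indiscernible (openL a)   b (both≤-N z≤-N _)  h =
  ⊥-elim (ℤ.<⇒≱ (∣a∣<N⇒-N<a b) (ℤ.≤-trans (ℤ.<⇒≤ h) z≤-N))

belowU-indiscernible : ∀ {N z z′} u → upperBound u < N → Indiscernible N z z′ → belowU u z → belowU u z′
belowU-indiscernible u           _ (equal refl)      h = h
belowU-indiscernible +∞          _ _                 _ = tt
belowU-indiscernible (closedU b) c (both≤-N _ z′≤-N) _ = ℤ.<⇒≤ (ℤ.≤-<-trans z′≤-N (∣a∣<N⇒-N<a c))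
belowU-indiscernible (closedU b) c (both≥N N≤z _)    h = ⊥-elim (ℤ.<⇒≱ (∣a∣<N⇒a<N c) (ℤ.≤-trans N≤z h))
belowU-indiscernible (openU b)   c (both≤-N _ z′≤-N) _ = ℤ.≤-<-trans z′≤-N (∣a∣<N⇒-N<a c)
belowU-indiscernible (openU b)   c (both≥N N≤z _)    h =
  ⊥-elim (ℤ.<⇒≱ (∣a∣<N⇒a<N c) (ℤ.≤-trans N≤z (ℤ.<⇒≤ h)))

∈I-indiscernible : ∀ {N z z′} I → bound I < N → Indiscernible N z z′ → z ∈I I → z′ ∈I I
∈I-indiscernible ⟨ l , u ⟩ b c (above , below) =
  aboveL-indiscernible l (m⊔n<o⇒m<o _ _ b) c above , belowU-indiscernible u (m⊔n<o⇒n<o _ _ b) c below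

scaledDiff : ℕ → ℕ → ℕ → ℤ
scaledDiff N x y = + (N * x) ℤ.- + (N * y)

scaled-gap : ∀ N {x y} → y < x → N ≤ N * x ∸ N * y
scaled-gap N {x} {y} y<x = m+n≤o⇒m≤o∸n N (subst (_≤ N * x) (*-suc N y) (*-monoʳ-≤ N y<x))

scaledDiff-≡ : ∀ N x → scaledDiff N x x ≡ + 0
scaledDiff-≡ N x = trans (ℤ.m-n≡m⊖n (N * x) (N * x)) (ℤ.n⊖n≡0 (N * x))

scaledDiff-> : ∀ N {x y} → y < x → + N ℤ.≤ scaledDiff N x y
scaledDiff-> N {x} {y} y<x =
  subst (+ N ℤ.≤_) (sym (trans (ℤ.m-n≡m⊖n (N * x) (N * y)) (ℤ.⊖-≥ (*-monoʳ-≤ N (<⇒≤ y<x)))))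
    (+≤+ (scaled-gap N y<x))

scaledDiff-< : ∀ N {x y} → x < y → scaledDiff N x y ℤ.≤ - + N
scaledDiff-< N {x} {y} x<y =
  subst (ℤ._≤ - + N) (sym (trans (ℤ.m-n≡m⊖n (N * x) (N * y)) (ℤ.⊖-≤ (*-monoʳ-≤ N (<⇒≤ x<y)))))
    (ℤ.neg-mono-≤ (+≤+ (scaled-gap N x<y)))

SameOrder⇒Indiscernible : ∀ N {x y x′ y′} → SameOrder x y x′ y′ →
                          Indiscernible N (scaledDiff N x y) (scaledDiff N x′ y′)
SameOrder⇒Indiscernible N (both< p q)         = both≤-N (scaledDiff-< N p) (scaledDiff-< N q)
SameOrder⇒Indiscernible N (both≡ refl refl)   = equal (trans (scaledDiff-≡ N _) (sym (scaledDiff-≡ N _)))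
SameOrder⇒Indiscernible N (both> p q)         = both≥N (scaledDiff-> N p) (scaledDiff-> N q)

1≤scaledDiff⇒> : ∀ N {x y} → + 1 ℤ.≤ scaledDiff N x y → y < x
1≤scaledDiff⇒> N h = ≰⇒> λ x≤y →
  contradiction (ℤ.≤-trans h (ℤ.i≤j⇒i-j≤0 (+≤+ (*-monoʳ-≤ N x≤y)))) λ { (+≤+ ()) }

scaledDiff≤-1⇒< : ∀ N {x y} → scaledDiff N x y ℤ.≤ - + 1 → x < y
scaledDiff≤-1⇒< N h = ≰⇒> λ y≤x →
  contradiction (ℤ.≤-trans (ℤ.i≤j⇒0≤j-i (+≤+ (*-monoʳ-≤ N y≤x))) h) λ ()

-- Until-rounds of the Ehrenfeucht–Fraïssé game

Forth : (ℕ → ℕ → Set) → ℕ → ℕ → Set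
Forth P i i′ = ∀ j → i < j → Σ ℕ λ j′ → i′ < j′ × P j j′ ×
                 (∀ k′ → i′ < k′ → k′ < j′ → Σ ℕ λ k → i < k × k < j × P k k′)

Forth-map : ∀ {P Q : ℕ → ℕ → Set} {i i′} →
            (∀ {j j′} → i < j → i′ < j′ → P j j′ → Q j j′) → Forth P i i′ → Forth Q i i′
Forth-map f forth j i<j with forth j i<j
... | j′ , i′<j′ , p , between = j′ , i′<j′ , f i<j i′<j′ p , λ k′ i′<k′ k′<j′ →
  let (k , i<k , k<j , q) = between k′ i′<k′ k′<j′ in k , i<k , k<j , f i<k i′<k′ q

Forth-id : ∀ {P : ℕ → ℕ → Set} → (∀ {δ} → 0 < δ → P δ δ) → Forth P 0 0
Forth-id p δ 0<δ = δ , 0<δ , p 0<δ , λ ε 0<ε ε<δ → ε , 0<ε , ε<δ , p 0<ε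

Forth-shift : ∀ {P : ℕ → ℕ → Set} {i i′} → Forth (λ δ δ′ → P (i + δ) (i′ + δ′)) 0 0 → Forth P i i′
Forth-shift {P} {i} {i′} forth j i<j with forth (j ∸ i) (m<n⇒0<n∸m i<j)
... | δ′ , 0<δ′ , p , between =
  i′ + δ′ , m<m+n i′ 0<δ′ , subst (λ t → P t (i′ + δ′)) (m+[n∸m]≡n (<⇒≤ i<j)) p , λ k′ i′<k′ k′<j′ →
  let (ε , 0<ε , ε<δ , q) = between (k′ ∸ i′) (m<n⇒0<n∸m i′<k′) (∸-offset-< i′<k′ k′<j′)
  in i + ε , m<m+n i 0<ε , subst (i + ε <_) (m+[n∸m]≡n (<⇒≤ i<j)) (+-monoʳ-< i ε<δ) ,
     subst (P (i + ε)) (m+[n∸m]≡n (<⇒≤ i′<k′)) q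
  where
  ∸-offset-< : ∀ {k′ δ′} → i′ < k′ → k′ < i′ + δ′ → k′ ∸ i′ < δ′
  ∸-offset-< {k′} {δ′} i′<k′ k′<j′ = subst (k′ ∸ i′ <_) (m+n∸m≡n i′ δ′) (∸-monoˡ-< k′<j′ (<⇒≤ i′<k′))

Forth-cons : ∀ {P : ℕ → ℕ → Set} {i i′} → P (suc i) (suc i′) → Forth P (suc i) (suc i′) → Forth P i i′
Forth-cons {P} {i} {i′} p forth j i<j with <-cmp j (suc i)
... | tri< j<1+i _ _ = ⊥-elim (<⇒≱ i<j (≤-pred j<1+i))
... | tri≈ _ refl _ = suc i′ , ≤-refl , p , λ k′ i′<k′ k′<1+i′ → ⊥-elim (<⇒≱ i′<k′ (≤-pred k′<1+i′))
... | tri> _ _ 1+i<j with forth j 1+i<j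
...   | j′ , 1+i′<j′ , q , between = j′ , <-trans (n<1+n i′) 1+i′<j′ , q , between′
  where
  between′ : ∀ k′ → i′ < k′ → k′ < j′ → Σ ℕ λ k → i < k × k < j × P k k′
  between′ k′ i′<k′ k′<j′ with <-cmp k′ (suc i′)
  ... | tri< k′<1+i′ _ _ = ⊥-elim (<⇒≱ i′<k′ (≤-pred k′<1+i′))
  ... | tri≈ _ refl _ = suc i , n<1+n i , 1+i<j , p
  ... | tri> _ _ 1+i′<k′ =
    let (k , 1+i<k , k<j , r) = between k′ 1+i′<k′ k′<j′ in k , <-trans (n<1+n i) 1+i<k , k<j , r

infix 4 _∼[_]_
data _∼[_]_ : ℕ → ℕ → ℕ → Set where
  same  : ∀ {x n} → x ∼[ n ] x
  large : ∀ {x y n} → n < x → n < y → x ∼[ n ] y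

∼-weaken : ∀ {x y n} → x ∼[ suc n ] y → x ∼[ n ] y
∼-weaken same              = same
∼-weaken (large n<x n<y) = large (<-trans (n<1+n _) n<x) (<-trans (n<1+n _) n<y)

∼-sym : ∀ {x y n} → x ∼[ n ] y → y ∼[ n ] x
∼-sym same              = same
∼-sym (large n<x n<y) = large n<y n<x

private
  <-∸-swap : ∀ {a b c} → a < b ∸ c → c < b ∸ a
  <-∸-swap {a} {b} {c} h =
    m+n≤o⇒m≤o∸n (suc c) (subst (λ t → suc t ≤ b) (+-comm a c) (m≤o∸n⇒m+n≤o (suc a) c≤b h))
    where
    c≤b : c ≤ b
    c≤b = <⇒≤ (m∸n≢0⇒n<m (m<n⇒n≢0 h))

  ∸-<-swap : ∀ {c δ x} → 0 < δ → c ∸ δ < x → c ∸ x < δ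
  ∸-<-swap {c} {δ} {x} 0<δ h = m<n+o⇒m∸n<o c x {{>-nonZero 0<δ}}
    (subst (c <_) (+-comm δ x) (≤-<-trans (m≤n+m∸n c δ) (+-monoʳ-< δ h)))

  <∸1 : ∀ {n c} → suc n < c → n < c ∸ 1
  <∸1 {c = suc c} (s≤s h) = h

-- c ∸ δ is the number of a's left after δ steps in  aᶜ b^ω : Duplicator's strategy in the
-- Ehrenfeucht–Fraïssé game for LTL on  aᶜ b^ω  versus  aᶜ′ b^ω.
countdown-forth : ∀ {c c′ n} → c ∼[ suc n ] c′ → Forth (λ δ δ′ → c ∸ δ ∼[ n ] c′ ∸ δ′) 0 0
countdown-forth same = Forth-id λ _ → same
countdown-forth {c} {c′} {n} (large n<c n<c′) δ 0<δ with n <? c ∸ δ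
... | yes n<c∸δ = 1 , s≤s z≤n , large n<c∸δ (<∸1 n<c′) , λ { _ (s≤s z≤n) (s≤s ()) }
... | no  n≮c∸δ =
  c′ ∸ x , m<n⇒0<n∸m x<c′ , subst (x ∼[ n ]_) (sym (m∸[m∸n]≡n (<⇒≤ x<c′))) same , between
  where
  x : ℕ
  x = c ∸ δ
  x<c′ : x < c′
  x<c′ = ≤-<-trans (≮⇒≥ n≮c∸δ) (<-trans (n<1+n n) n<c′)
  between : ∀ ε′ → 0 < ε′ → ε′ < c′ ∸ x → Σ ℕ λ ε → 0 < ε × ε < δ × c ∸ ε ∼[ n ] c′ ∸ ε′
  between ε′ 0<ε′ ε′<δ′ with n <? c′ ∸ ε′
  ... | yes n<c′∸ε′ = 1 , s≤s z≤n , 1<δ , large (<∸1 n<c) n<c′∸ε′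
    where
    1<δ : 1 < δ
    1<δ = ≤∧≢⇒< 0<δ λ { refl → n≮c∸δ (<∸1 n<c) }
  ... | no  n≮c′∸ε′ =
    c ∸ x′ , m<n⇒0<n∸m x′<c , ∸-<-swap 0<δ (<-∸-swap ε′<δ′) ,
    subst (_∼[ n ] x′) (sym (m∸[m∸n]≡n (<⇒≤ x′<c))) same
    where
    x′ : ℕ
    x′ = c′ ∸ ε′
    x′<c : x′ < c
    x′<c = ≤-<-trans (≮⇒≥ n≮c′∸ε′) (<-trans (n<1+n n) n<c)

countdown-forth-from : ∀ {K K′ n i i′} → K ∸ i ∼[ suc n ] K′ ∸ i′ →
                       Forth (λ j j′ → K ∸ j ∼[ n ] K′ ∸ j′) i i′
countdown-forth-from {K} {K′} {n} {i} {i′} r =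
  Forth-shift (Forth-map (λ {δ} {δ′} _ _ → subst₂ (_∼[ n ]_) (∸-+-assoc K i δ) (∸-+-assoc K′ i′ δ′))
                         (countdown-forth r))

∼-zero-or-positive : ∀ {x y n} → x ∼[ n ] y → (x ≡ 0 × y ≡ 0) ⊎ (0 < x × 0 < y)
∼-zero-or-positive {zero}  same = inj₁ (refl , refl)
∼-zero-or-positive {suc _} same = inj₂ (s≤s z≤n , s≤s z≤n)
∼-zero-or-positive (large n<x n<y) = inj₂ (≤-<-trans z≤n n<x , ≤-<-trans z≤n n<y)

-- One-register formulas cannot separate bisimilar scaled words

untilDepth : ∀ {k} → TPTL k → ℕ
untilDepth (prop _)  = 0
untilDepth (_ ∈ᵣ _)  = 0
untilDepth (¬' φ)    = untilDepth φ
untilDepth (φ ∧' ψ)  = untilDepth φ ⊔ untilDepth ψ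
untilDepth (φ U ψ)   = suc (untilDepth φ ⊔ untilDepth ψ)
untilDepth (_ · φ)   = untilDepth φ

maxConstant : ∀ {k} → TPTL k → ℕ
maxConstant (prop _) = 0
maxConstant (_ ∈ᵣ I) = bound I
maxConstant (¬' φ)   = maxConstant φ
maxConstant (φ ∧' ψ) = maxConstant φ ⊔ maxConstant ψ
maxConstant (φ U ψ)  = maxConstant φ ⊔ maxConstant ψ
maxConstant (_ · φ)  = maxConstant φ

OnlyRegister : ∀ {k} → Reg → TPTL k → Set
OnlyRegister r ψ = All (_≡ r) (regs ψ)

update-≡ : ∀ (ν : Valuation) x d → (ν [ x ↦ d ]) x ≡ d
update-≡ ν x d with x ≟ x
... | yes _ = refl
... | no x≢x = ⊥-elim (x≢x refl)

scaledWord : ∀ k → ℕ → (ℕ → ℕ) → DataWord k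
scaledWord k N g p = ∅ , N * g p

U-transfer : ∀ {k} {w w′ : DataWord k} {ν ν′ φ ψ} {P : ℕ → ℕ → Set} {i i′} → Forth P i i′ →
             (∀ {j j′} → P j j′ → Sat w j ν φ → Sat w′ j′ ν′ φ) →
             (∀ {j j′} → P j j′ → Sat w j ν ψ → Sat w′ j′ ν′ ψ) →
             Sat w i ν (φ U ψ) → Sat w′ i′ ν′ (φ U ψ)
U-transfer forth transferφ transferψ (j , i<j , satψ , satφ) =
  let (j′ , i′<j′ , p , between) = forth j i<j in
  j′ , i′<j′ , transferψ p satψ , λ k′ i′<k′ k′<j′ →
    let (k , i<k , k<j , q) = between k′ i′<k′ k′<j′ in transferφ q (satφ k i<k k<j)

-- Related n i u i′ u′: Duplicator survives n Until-rounds from position i of g with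
-- register value u against position i′ of g′ with register value u′ (values unscaled).
record Bisimulation (g g′ : ℕ → ℕ) : Set₁ where
  field
    Related : ℕ → ℕ → ℕ → ℕ → ℕ → Set
    local   : ∀ {n i u i′ u′} → Related n i u i′ u′ → SameOrder (g i) u (g′ i′) u′
    freeze  : ∀ {n i u i′ u′} → Related n i u i′ u′ → Related n i (g i) i′ (g′ i′)
    forth   : ∀ {n i u i′ u′} → Related (suc n) i u i′ u′ → Forth (λ j j′ → Related n j u j′ u′) i i′
    back    : ∀ {n i u i′ u′} → Related (suc n) i u i′ u′ → Forth (λ j′ j → Related n j u j′ u′) i′ i

module _ {k N : ℕ} {g g′ : ℕ → ℕ} (B : Bisimulation g g′) (r : Reg) where
  open Bisimulation B

  private
    W W′ : DataWord k
    W  = scaledWord k N g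
    W′ = scaledWord k N g′

  bisimilar-agree : ∀ (ψ : TPTL k) {n i u i′ u′ ν ν′} →
    OnlyRegister r ψ → untilDepth ψ ≤ n → maxConstant ψ < N →
    ν r ≡ N * u → ν′ r ≡ N * u′ → Related n i u i′ u′ →
    Sat W i ν ψ ⇔ Sat W′ i′ ν′ ψ
  bisimilar-agree (prop _) _ _ _ _ _ _ = mk⇔ id id
  bisimilar-agree (_ ∈ᵣ I) (refl ∷ []) _ c<N e e′ rel rewrite e | e′ =
    mk⇔ (∈I-indiscernible I c<N (SameOrder⇒Indiscernible N (local rel)))
        (∈I-indiscernible I c<N (SameOrder⇒Indiscernible N (SameOrder-sym (local rel))))
  bisimilar-agree (¬' φ) only d c<N e e′ rel = ¬-cong-⇔ (bisimilar-agree φ only d c<N e e′ rel)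
  bisimilar-agree (φ ∧' ψ) only d c<N e e′ rel =
    bisimilar-agree φ (++⁻ˡ (regs φ) only) (m⊔n≤o⇒m≤o _ _ d) (m⊔n<o⇒m<o _ _ c<N) e e′ rel ×-⇔
    bisimilar-agree ψ (++⁻ʳ (regs φ) only) (m⊔n≤o⇒n≤o _ _ d) (m⊔n<o⇒n<o _ _ c<N) e e′ rel
  bisimilar-agree (φ U ψ) {suc n} {u = u} {u′ = u′} {ν} {ν′} only (s≤s d) c<N e e′ rel =
    mk⇔ (U-transfer {φ = φ} {ψ} (forth rel) (Equivalence.to ∘ agreeφ) (Equivalence.to ∘ agreeψ))
        (U-transfer {φ = φ} {ψ} (back rel) (Equivalence.from ∘ agreeφ) (Equivalence.from ∘ agreeψ))
    where
    agreeφ : ∀ {j j′} → Related n j u j′ u′ → Sat W j ν φ ⇔ Sat W′ j′ ν′ φ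
    agreeφ = bisimilar-agree φ (++⁻ˡ (regs φ) only) (m⊔n≤o⇒m≤o _ _ d) (m⊔n<o⇒m<o _ _ c<N) e e′
    agreeψ : ∀ {j j′} → Related n j u j′ u′ → Sat W j ν ψ ⇔ Sat W′ j′ ν′ ψ
    agreeψ = bisimilar-agree ψ (++⁻ʳ (regs φ) only) (m⊔n≤o⇒n≤o _ _ d) (m⊔n<o⇒n<o _ _ c<N) e e′
  bisimilar-agree (_ · φ) {i = i} {i′ = i′} {ν = ν} {ν′} (refl ∷ only) d c<N _ _ rel =
    bisimilar-agree φ only d c<N (update-≡ ν r (N * g i)) (update-≡ ν′ r (N * g′ i′)) (freeze rel)

-- The bisimulation between W and W′

OrderIso : (ℕ → ℕ) → ℕ → (ℕ → ℕ) → ℕ → Set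
OrderIso g i g′ i′ = ∀ δ ε → SameOrder (g (i + δ)) (g (i + ε)) (g′ (i′ + δ)) (g′ (i′ + ε))

record SuffixIso (g : ℕ → ℕ) (i u : ℕ) (g′ : ℕ → ℕ) (i′ u′ : ℕ) : Set where
  constructor suffixIso
  field
    register : ∀ δ → SameOrder (g (i + δ)) u (g′ (i′ + δ)) u′
    order    : OrderIso g i g′ i′

module _ {g g′ : ℕ → ℕ} {i i′ : ℕ} where

  SuffixIso-shift : ∀ {u u′} δ → SuffixIso g i u g′ i′ u′ → SuffixIso g (i + δ) u g′ (i′ + δ) u′
  SuffixIso-shift δ (suffixIso ρ o) = suffixIso register order
    where
    register : ∀ ε → SameOrder (g (i + δ + ε)) _ (g′ (i′ + δ + ε)) _
    register ε rewrite +-assoc i δ ε | +-assoc i′ δ ε = ρ (δ + ε)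
    order : OrderIso g (i + δ) g′ (i′ + δ)
    order ε ε′ rewrite +-assoc i δ ε | +-assoc i′ δ ε | +-assoc i δ ε′ | +-assoc i′ δ ε′ =
      o (δ + ε) (δ + ε′)

  SuffixIso-sym : ∀ {u u′} → SuffixIso g i u g′ i′ u′ → SuffixIso g′ i′ u′ g i u
  SuffixIso-sym (suffixIso ρ o) = suffixIso (SameOrder-sym ∘ ρ) (λ δ ε → SameOrder-sym (o δ ε))

  OrderIso⇒SuffixIso : OrderIso g i g′ i′ → SuffixIso g i (g i) g′ i′ (g′ i′)
  OrderIso⇒SuffixIso o = suffixIso register o
    where
    register : ∀ δ → SameOrder (g (i + δ)) (g i) (g′ (i′ + δ)) (g′ i′)
    register δ = subst₂ (λ x x′ → SameOrder (g (i + δ)) (g x) (g′ (i′ + δ)) (g′ x′))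
                        (+-identityʳ i) (+-identityʳ i′) (o δ 0)

SuffixIso-here : ∀ {g g′ i u i′ u′} → SuffixIso g i u g′ i′ u′ → SameOrder (g i) u (g′ i′) u′
SuffixIso-here {g} {g′} {i} {u} {i′} {u′} s =
  subst₂ (λ x x′ → SameOrder (g x) u (g′ x′) u′) (+-identityʳ i) (+-identityʳ i′)
         (SuffixIso.register s 0)

IncreasingFrom : ℕ → (ℕ → ℕ) → Set
IncreasingFrom i g = ∀ {p q} → i ≤ p → p < q → g p < g q

increasing⇒OrderIso : ∀ {g g′ i i′} → IncreasingFrom i g → IncreasingFrom i′ g′ → OrderIso g i g′ i′
increasing⇒OrderIso {i = i} {i′} inc inc′ δ ε with <-cmp δ ε
... | tri< δ<ε _ _ = both< (inc (m≤m+n i δ) (+-monoʳ-< i δ<ε)) (inc′ (m≤m+n i′ δ) (+-monoʳ-< i′ δ<ε))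
... | tri≈ _ refl _ = both≡ refl refl
... | tri> _ _ ε<δ = both> (inc (m≤m+n i ε) (+-monoʳ-< i ε<δ)) (inc′ (m≤m+n i′ ε) (+-monoʳ-< i′ ε<δ))

gap-SameOrder : ∀ {v x x′ lo hi} → v < lo ⊎ hi < v → lo ≤ x × x ≤ hi → lo ≤ x′ × x′ ≤ hi →
                SameOrder x v x′ v
gap-SameOrder (inj₁ v<lo) (lo≤x , _) (lo≤x′ , _) = both> (<-≤-trans v<lo lo≤x) (<-≤-trans v<lo lo≤x′)
gap-SameOrder (inj₂ hi<v) (_ , x≤hi) (_ , x′≤hi) = both< (≤-<-trans x≤hi hi<v) (≤-<-trans x′≤hi hi<v)

perturb-OrderIso : ∀ {g g′ : ℕ → ℕ} {i h lo hi} →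
  (∀ {p} → p ≢ h → g p ≡ g′ p) → (∀ {p} → i ≤ p → p ≢ h → g p < lo ⊎ hi < g p) →
  lo ≤ g h × g h ≤ hi → lo ≤ g′ h × g′ h ≤ hi → OrderIso g i g′ i
perturb-OrderIso {g} {g′} {i} {h} agree gap inside inside′ δ ε with i + δ ≟ h | i + ε ≟ h
... | yes p≡h | yes q≡h rewrite p≡h | q≡h = both≡ refl refl
... | yes p≡h | no  q≢h rewrite p≡h =
  subst (SameOrder (g h) (g (i + ε)) (g′ h)) (agree q≢h)
        (gap-SameOrder (gap (m≤m+n i ε) q≢h) inside inside′)
... | no  p≢h | yes q≡h rewrite q≡h =
  subst (λ v → SameOrder (g (i + δ)) (g h) v (g′ h)) (agree p≢h)
        (SameOrder-flip (gap-SameOrder (gap (m≤m+n i δ) p≢h) inside inside′))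
... | no  p≢h | no  q≢h rewrite agree p≢h | agree q≢h = SameOrder-refl _ _

-- While the register still holds a = g 0, positions i ≥ 2 are matched by their distance
-- K ∸ i to the position K where the word climbs back above a; positions 0 and 1 are
-- matched to themselves and carry the counter of position 1.
data CountPhase (K K′ n : ℕ) : ℕ → ℕ → Set where
  at0   : K ∸ 1 ∼[ n ] K′ ∸ 1 → CountPhase K K′ n 0 0
  at1   : K ∸ 1 ∼[ n ] K′ ∸ 1 → CountPhase K K′ n 1 1
  later : ∀ {i i′} → 2 ≤ i → 2 ≤ i′ → K ∸ i ∼[ n ] K′ ∸ i′ → CountPhase K K′ n i i′

module _ {K K′ n : ℕ} where

  later-forth : ∀ {i i′} → 1 ≤ i → 1 ≤ i′ → K ∸ i ∼[ suc n ] K′ ∸ i′ → Forth (CountPhase K K′ n) i i′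
  later-forth 1≤i 1≤i′ c = Forth-map (λ i<j i′<j′ → later (≤-<-trans 1≤i i<j) (≤-<-trans 1≤i′ i′<j′))
                                     (countdown-forth-from c)

  CountPhase-forth : ∀ {i i′} → CountPhase K K′ (suc n) i i′ → Forth (CountPhase K K′ n) i i′
  CountPhase-forth (at0 c)            = Forth-cons (at1 (∼-weaken c)) (later-forth (s≤s z≤n) (s≤s z≤n) c)
  CountPhase-forth (at1 c)            = later-forth (s≤s z≤n) (s≤s z≤n) c
  CountPhase-forth (later 2≤i 2≤i′ c) = later-forth (<⇒≤ 2≤i) (<⇒≤ 2≤i′) c

  CountPhase-swap : ∀ {i i′} → CountPhase K K′ n i i′ → CountPhase K′ K n i′ i
  CountPhase-swap (at0 c)            = at0 (∼-sym c)
  CountPhase-swap (at1 c)            = at1 (∼-sym c)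
  CountPhase-swap (later 2≤i 2≤i′ c) = later 2≤i′ 2≤i (∼-sym c)

data Related (a K K′ : ℕ) (g g′ : ℕ → ℕ) (n : ℕ) : ℕ → ℕ → ℕ → ℕ → Set where
  counting : ∀ {i i′} → CountPhase K K′ n i i′ → Related a K K′ g g′ n i a i′ a
  aligned  : ∀ {i u i′ u′} → SuffixIso g i u g′ i′ u′ → Related a K K′ g g′ n i u i′ u′

module _ {a K K′ : ℕ} {g g′ : ℕ → ℕ} where

  Related-forth : ∀ {n i u i′ u′} → Related a K K′ g g′ (suc n) i u i′ u′ →
                  Forth (λ j j′ → Related a K K′ g g′ n j u j′ u′) i i′
  Related-forth (counting c) = Forth-map (λ _ _ → counting) (CountPhase-forth c)
  Related-forth (aligned s)  = Forth-shift (Forth-id λ {δ} _ → aligned (SuffixIso-shift δ s))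

  Related-swap : ∀ {n i u i′ u′} → Related a K K′ g g′ n i u i′ u′ → Related a K′ K g′ g n i′ u′ i u
  Related-swap (counting c) = counting (CountPhase-swap c)
  Related-swap (aligned s)  = aligned (SuffixIso-sym s)

Related-back : ∀ {a K K′ g g′ n i u i′ u′} → Related a K K′ g g′ (suc n) i u i′ u′ →
               Forth (λ j′ j → Related a K K′ g g′ n j u j′ u′) i′ i
Related-back rel = Forth-map (λ _ _ → Related-swap) (Related-forth (Related-swap rel))

Threshold : (ℕ → ℕ) → ℕ → ℕ → Set
Threshold g a K = ∀ {i} → 2 ≤ i → (i < K → g i < a) × (K ≤ i → a < g i)

threshold-SameOrder : ∀ {g g′ a K K′ n i i′} → Threshold g a K → Threshold g′ a K′ →
                      2 ≤ i → 2 ≤ i′ → K ∸ i ∼[ n ] K′ ∸ i′ → SameOrder (g i) a (g′ i′) a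
threshold-SameOrder t t′ 2≤i 2≤i′ c with ∼-zero-or-positive c
... | inj₁ (z , z′) = both> (proj₂ (t 2≤i) (m∸n≡0⇒m≤n z)) (proj₂ (t′ 2≤i′) (m∸n≡0⇒m≤n z′))
... | inj₂ (p , p′) =
  both< (proj₁ (t 2≤i) (m∸n≢0⇒n<m (n>0⇒n≢0 p))) (proj₁ (t′ 2≤i′) (m∸n≢0⇒n<m (n>0⇒n≢0 p′)))

-- word m c = 3+m, 5+m, 2, 3, …, m+1, c, m+6, m+7, …  with c at position m+2.
word : ℕ → ℕ → ℕ → ℕ
word m c zero          = 3 + m
word m c (suc zero)    = 5 + m
word m c (suc (suc q)) with <-cmp q m
... | tri< _ _ _ = 2 + q
... | tri≈ _ _ _ = c
... | tri> _ _ _ = 5 + q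

module _ (m c : ℕ) where

  word-hole : word m c (2 + m) ≡ c
  word-hole with <-cmp m m
  ... | tri< m<m _ _ = ⊥-elim (<-irrefl refl m<m)
  ... | tri≈ _ _ _   = refl
  ... | tri> _ _ m>m = ⊥-elim (<-irrefl refl m>m)

  word-low : ∀ {q} → q < m → word m c (2 + q) ≡ 2 + q
  word-low {q} q<m with <-cmp q m
  ... | tri< _ _ _    = refl
  ... | tri≈ q≮m _ _  = ⊥-elim (q≮m q<m)
  ... | tri> q≮m _ _  = ⊥-elim (q≮m q<m)

  word-high : ∀ {q} → m < q → word m c (2 + q) ≡ 5 + q
  word-high {q} m<q with <-cmp q m
  ... | tri< _ _ q≯m  = ⊥-elim (q≯m m<q)
  ... | tri≈ _ _ q≯m  = ⊥-elim (q≯m m<q)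
  ... | tri> _ _ _    = refl

  word-increasing : suc m < c → c < 6 + m → IncreasingFrom 2 (word m c)
  word-increasing _ _ {suc zero} (s≤s ()) _
  word-increasing m<c c<6+m {suc (suc p)} {suc (suc q)} _ (s≤s (s≤s p<q)) with <-cmp p m | <-cmp q m
  ... | tri< _ _ _     | tri< _ _ _     = s≤s (s≤s p<q)
  ... | tri< p<m _ _   | tri≈ _ _ _     = ≤-<-trans (s≤s p<m) m<c
  ... | tri< _ _ _     | tri> _ _ _     = <-trans (s≤s (s≤s p<q)) (m<n+m (2 + q) {3} (s≤s z≤n))
  ... | tri≈ _ refl _  | tri< q<p _ _   = ⊥-elim (<-asym p<q q<p)
  ... | tri≈ _ refl _  | tri≈ _ refl _  = ⊥-elim (<-irrefl refl p<q)
  ... | tri≈ _ refl _  | tri> _ _ _     = <-≤-trans c<6+m (s≤s (s≤s (s≤s (s≤s (s≤s p<q)))))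
  ... | tri> _ _ m<p   | tri< q<m _ _   = ⊥-elim (<-asym (<-trans q<m m<p) p<q)
  ... | tri> _ _ m<p   | tri≈ _ refl _  = ⊥-elim (<-asym m<p p<q)
  ... | tri> _ _ _     | tri> _ _ _     = s≤s (s≤s (s≤s (s≤s (s≤s p<q))))

  word-below : ∀ {p} → 2 ≤ p → p < 2 + m → word m c p < 3 + m
  word-below {suc zero} (s≤s ()) _
  word-below {suc (suc q)} _ (s≤s (s≤s q<m)) rewrite word-low q<m = s≤s (s≤s (s≤s (<⇒≤ q<m)))

  word-beyond : ∀ {p} → 3 + m ≤ p → 5 + m < word m c p
  word-beyond {suc (suc q)} (s≤s (s≤s m<q)) rewrite word-high m<q = s≤s (s≤s (s≤s (s≤s (s≤s m<q))))

  word-gap : ∀ {p} → 1 ≤ p → p ≢ 2 + m → word m c p < 2 + m ⊎ 4 + m < word m c p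
  word-gap {suc zero} _ _ = inj₂ (n<1+n (4 + m))
  word-gap {suc (suc q)} _ p≢h with <-cmp q m
  ... | tri< q<m _ _  = inj₁ (s≤s (s≤s q<m))
  ... | tri≈ _ refl _ = ⊥-elim (p≢h refl)
  ... | tri> _ _ m<q  = inj₂ (s≤s (s≤s (s≤s (s≤s (s≤s (<⇒≤ m<q))))))

word-agree : ∀ m c c′ {p} → p ≢ 2 + m → word m c p ≡ word m c′ p
word-agree m c c′ {zero} _ = refl
word-agree m c c′ {suc zero} _ = refl
word-agree m c c′ {suc (suc q)} p≢h with <-cmp q m
... | tri< _ _ _    = refl
... | tri≈ _ refl _ = ⊥-elim (p≢h refl)
... | tri> _ _ _    = refl

word-align : ∀ m {c c′} → 2 + m ≤ c × c ≤ 4 + m → 2 + m ≤ c′ × c′ ≤ 4 + m →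
             OrderIso (word m c) 1 (word m c′) 1
word-align m {c} {c′} c∈gap c′∈gap =
  perturb-OrderIso (word-agree m c c′) (word-gap m c)
    (subst (λ x → 2 + m ≤ x × x ≤ 4 + m) (sym (word-hole m c)) c∈gap)
    (subst (λ x → 2 + m ≤ x × x ≤ 4 + m) (sym (word-hole m c′)) c′∈gap)

module _ (m : ℕ) where

  threshold-above : Threshold (word m (4 + m)) (3 + m) (2 + m)
  threshold-above 2≤i = word-below m (4 + m) 2≤i , λ K≤i → case m≤n⇒m<n∨m≡n K≤i of λ where
    (inj₁ K<i)  → <-trans (m<n+m (3 + m) {2} (s≤s z≤n)) (word-beyond m (4 + m) K<i)
    (inj₂ refl) → subst (3 + m <_) (sym (word-hole m (4 + m))) (n<1+n (3 + m))

  threshold-below : Threshold (word m (2 + m)) (3 + m) (3 + m)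
  threshold-below 2≤i = (λ i<K → case m<1+n⇒m<n∨m≡n i<K of λ where
      (inj₁ i<2+m) → word-below m (2 + m) 2≤i i<2+m
      (inj₂ refl)  → subst (_< 3 + m) (sym (word-hole m (2 + m))) (n<1+n (2 + m))) ,
    λ K≤i → <-trans (m<n+m (3 + m) {2} (s≤s z≤n)) (word-beyond m (2 + m) K≤i)

  increasing-above : IncreasingFrom 2 (word m (4 + m))
  increasing-above =
    word-increasing m (4 + m) (s≤s (s≤s (m≤n+m m 2))) (s≤s (s≤s (s≤s (s≤s (s≤s (n≤1+n m))))))

  increasing-below : IncreasingFrom 2 (word m (2 + m))
  increasing-below = word-increasing m (2 + m) ≤-refl (s≤s (s≤s (s≤s (m≤n+m m 3))))

  bisimulation : Bisimulation (word m (4 + m)) (word m (2 + m))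
  bisimulation = record
    { Related = R
    ; local   = local
    ; freeze  = freeze
    ; forth   = Related-forth
    ; back    = Related-back
    }
    where
    g g′ : ℕ → ℕ
    g  = word m (4 + m)
    g′ = word m (2 + m)
    R : ℕ → ℕ → ℕ → ℕ → ℕ → Set
    R  = Related (3 + m) (2 + m) (3 + m) g g′

    local : ∀ {n i u i′ u′} → R n i u i′ u′ → SameOrder (g i) u (g′ i′) u′
    local (counting (at0 _))            = both≡ refl refl
    local (counting (at1 _))            = both> a<b a<b
      where
      a<b : 3 + m < 5 + m
      a<b = m<n+m (3 + m) {2} (s≤s z≤n)
    local (counting (later 2≤i 2≤i′ c)) = threshold-SameOrder threshold-above threshold-below 2≤i 2≤i′ c
    local (aligned s)                   = SuffixIso-here s

    freeze : ∀ {n i u i′ u′} → R n i u i′ u′ → R n i (g i) i′ (g′ i′)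
    freeze (counting (at0 c))            = counting (at0 c)
    freeze (counting (at1 _))            =
      aligned (OrderIso⇒SuffixIso (word-align m (m≤n+m (2 + m) 2 , ≤-refl) (≤-refl , m≤n+m (2 + m) 2)))
    freeze (counting (later 2≤i 2≤i′ _)) =
      aligned (OrderIso⇒SuffixIso
        (increasing⇒OrderIso (increasing-above ∘ ≤-trans 2≤i) (increasing-below ∘ ≤-trans 2≤i′)))
    freeze (aligned s)                   = aligned (OrderIso⇒SuffixIso (SuffixIso.order s))

DescentAboveStart : (ℕ → ℕ) → Set
DescentAboveStart g = Σ ℕ λ j → Σ ℕ λ j₂ → 0 < j × j < j₂ × g 0 < g j × g 0 < g j₂ × g j₂ < g j

∈I-1-inf⇔> : ∀ N {x y} → scaledDiff (suc N) x y ∈I I-1-inf ⇔ y < x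
∈I-1-inf⇔> N = mk⇔ (1≤scaledDiff⇒> (suc N) ∘ proj₁)
                   λ y<x → ℤ.≤-trans (+≤+ (s≤s z≤n)) (scaledDiff-> (suc N) y<x) , tt

∈I-inf-m1⇔< : ∀ N {x y} → scaledDiff (suc N) x y ∈I I-inf-m1 ⇔ x < y
∈I-inf-m1⇔< N = mk⇔ (scaledDiff≤-1⇒< (suc N) ∘ proj₂)
                     λ x<y → tt , ℤ.≤-trans (scaledDiff-< (suc N) x<y) (ℤ.neg-mono-≤ (+≤+ (s≤s z≤n)))

φ₁₃-scaled : ∀ k N g → scaledWord k (suc N) g ⊨ φ₁₃ k ⇔ DescentAboveStart g
φ₁₃-scaled k N g = mk⇔
  (λ (j , 0<j , (above , j₂ , j<j₂ , (above₂ , below) , _) , _) →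
     j , j₂ , 0<j , j<j₂ , to (∈I-1-inf⇔> N) above , to (∈I-1-inf⇔> N) above₂ , to (∈I-inf-m1⇔< N) below)
  (λ (j , j₂ , 0<j , j<j₂ , above , above₂ , below) →
     j , 0<j , (from (∈I-1-inf⇔> N) above , j₂ , j<j₂ ,
                (from (∈I-1-inf⇔> N) above₂ , from (∈I-inf-m1⇔< N) below) , λ _ _ _ (p , q) → p q) ,
     λ _ _ _ (p , q) → p q)
  where open Equivalence

module _ (m : ℕ) where

  descent-above : DescentAboveStart (word m (4 + m))
  descent-above = 1 , 2 + m , s≤s z≤n , s≤s (s≤s z≤n) , m<n+m (3 + m) {2} (s≤s z≤n) ,
    subst (λ x → 3 + m < x × x < 5 + m) (sym (word-hole m (4 + m))) (n<1+n (3 + m) , n<1+n (4 + m))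

  no-descent-below : ¬ DescentAboveStart (word m (2 + m))
  no-descent-below (suc zero , j₂ , _ , 1<j₂ , _ , a<gj₂ , gj₂<b) with j₂ <? 3 + m
  ... | yes j₂<3+m = <-asym a<gj₂ (proj₁ (threshold-below m 1<j₂) j₂<3+m)
  ... | no  j₂≮3+m = <-asym gj₂<b (word-beyond m (2 + m) (≮⇒≥ j₂≮3+m))
  no-descent-below (suc (suc j) , j₂ , _ , j<j₂ , _ , _ , gj₂<gj) =
    <-asym gj₂<gj (increasing-below m (s≤s (s≤s z≤n)) j<j₂)

single-register : ∀ {k} (ψ : TPTL k) → InTPTL 1 ψ → Σ Reg λ r → OnlyRegister r ψ
single-register _ ([]        , _      , sub) = 0 , All.tabulate λ x∈ψ → case sub _ x∈ψ of λ ()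
single-register _ (r ∷ []    , _      , sub) =
  r , All.tabulate λ x∈ψ → case sub _ x∈ψ of λ { (here x≡r) → x≡r }
single-register _ (_ ∷ _ ∷ _ , s≤s () , _)

φ₁₃∉TPTL¹ : ∀ k → ¬ (∃ λ ψ → InTPTL 1 ψ × (φ₁₃ k ≈ ψ))
φ₁₃∉TPTL¹ k (ψ , ψ∈TPTL¹ , φ≈ψ) with single-register ψ ψ∈TPTL¹
... | r , only = no-descent-below m (to (φ₁₃-scaled k N _) (from (φ≈ψ _) W′⊨ψ))
  where
  open Equivalence
  m N : ℕ
  m = untilDepth ψ
  N = maxConstant ψ
  W⊨ψ : scaledWord k (suc N) (word m (4 + m)) ⊨ ψ
  W⊨ψ = to (φ≈ψ _) (from (φ₁₃-scaled k N _) (descent-above m))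
  start : 1 + m ∼[ m ] 2 + m
  start = large (n<1+n m) (m<n+m m {2} (s≤s z≤n))
  W′⊨ψ : scaledWord k (suc N) (word m (2 + m)) ⊨ ψ
  W′⊨ψ = to (bisimilar-agree (bisimulation m) r ψ only ≤-refl ≤-refl refl refl (counting (at0 start)))
            W⊨ψ

trueAt : ∀ {k} → Reg → TPTL k
trueAt x = ¬' ((¬' (x ∈ᵣ ⟨ -∞ , +∞ ⟩)) ∧' (x ∈ᵣ ⟨ -∞ , +∞ ⟩))

-- φ₁₃ k is φ₁₃-via 0: true' mentions register 0, so φ₁₃ k itself uses three registers,
-- whereas the equivalent φ₁₃-via 1 lies in TPTL².
φ₁₃-via : ∀ {k} → Reg → TPTL k
φ₁₃-via x = 1 · (trueAt x U ((1 ∈ᵣ I-1-inf) ∧' (2 · (trueAt x U ((1 ∈ᵣ I-1-inf) ∧' (2 ∈ᵣ I-inf-m1))))))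

φ₁₃-via-≈ : ∀ {k} x y → φ₁₃-via {k} x ≈ φ₁₃-via y
φ₁₃-via-≈ x y w = mk⇔ (change x y) (change y x)
  where
  change : ∀ x y → w ⊨ φ₁₃-via x → w ⊨ φ₁₃-via y
  change _ _ (j , 0<j , (above , j₂ , j<j₂ , tests , _) , _) =
    j , 0<j , (above , j₂ , j<j₂ , tests , λ _ _ _ (p , q) → p q) , λ _ _ _ (p , q) → p q

φ₁₃-via-1∈TPTL² : ∀ k → InTPTL 2 (φ₁₃-via {k} 1)
φ₁₃-via-1∈TPTL² k = 1 ∷ 2 ∷ [] , ≤-refl , λ _ → All.lookup registers
  where
  registers : All (_∈ 1 ∷ 2 ∷ []) (regs (φ₁₃-via {k} 1))
  registers = toWitness {a? = all? (_∈? (1 ∷ 2 ∷ [])) (regs (φ₁₃-via {k} 1))} tt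

InTPTL-mono : ∀ {k m n} {φ : TPTL k} → m ≤ n → InTPTL m φ → InTPTL n φ
InTPTL-mono m≤n (rs , |rs|≤m , sub) = rs , ≤-trans |rs|≤m m≤n , sub

TPTL²≥TPTL¹ : AtLeastAsExpressive 2 1
TPTL²≥TPTL¹ _ φ φ∈TPTL¹ = φ , InTPTL-mono {φ = φ} (n≤1+n 1) φ∈TPTL¹ , λ _ → mk⇔ id id

TPTL¹≱TPTL² : ¬ AtLeastAsExpressive 1 2
TPTL¹≱TPTL² TPTL¹≥TPTL² with TPTL¹≥TPTL² 0 (φ₁₃-via 1) (φ₁₃-via-1∈TPTL² 0)
... | ψ , ψ∈TPTL¹ , φ≈ψ = φ₁₃∉TPTL¹ 0 (ψ , ψ∈TPTL¹ , λ w → ⇔-trans (φ₁₃-via-≈ 0 1 w) (φ≈ψ w))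

proposition13 : (∀ (k : ℕ) → ¬ (∃ λ ψ → InTPTL 1 ψ × (φ₁₃ k ≈ ψ)))
                × StrictlyMoreExpressive 2 1
proposition13 = φ₁₃∉TPTL¹ , TPTL²≥TPTL¹ , TPTL¹≱TPTL²
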